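{- Let $L$ be a totally ordered BL-algebra. Then every good sequence of $L$ is of the form $(1^p,a)$ for some integer $p\ge0$ and some $a\in L$.
   Context: A BL-algebra is an algebra $(L,\wedge,\vee,\otimes,\to,0,1)$ such that $(L,\wedge,\vee,0,1)$ is a bounded lattice, $(L,\otimes,1)$ is a commutative monoid, $x\otimes y\le z$ iff $x\le y\to z$, $x\wedge y=x\otimes(x\to y)$, and $(x\to y)\vee(y\to x)=1$. Put $\bar x=x\to0$, $x\oslash y=\bar x\to y$, $x+y=(x\oslash y)\wedge(y\oslash x)$. A good sequence of $L$ is a sequence $\mathbf{a}=(a_1,a_2,\ldots)$ in $L$ with $a_i+a_{i+1}=a_i$ for all $i$ and $a_r=0$ for all sufficiently large $r$. $(1^p,a)$ denotes the sequence whose first $p$ terms equal $1$, whose $(p+1)$-st term is $a$, and whose remaining terms are $0$. -}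

module Defs where

open import Level using (Level; suc; _⊔_)
open import Data.Nat as ℕ using (ℕ; _<?_; _≟_)
open import Data.Product using (Σ; ∃; _×_; _,_)
open import Data.Sum using (_⊎_)
open import Relation.Nullary using (yes; no)
open import Relation.Binary.PropositionalEquality using (_≡_)

record BLAlgebra (c : Level) : Set (Level.suc c) where
  infixr 7 _⊗_
  infixr 6 _∧_
  infixr 5 _∨_
  infixr 4 _⇒_
  infix 3 _≤_
  field
    Carrier : Set c
    _∧_ _∨_ _⊗_ _⇒_ : Carrier → Carrier → Carrier
    𝟘 𝟙 : Carrier
    ∧-assoc : ∀ x y z → (x ∧ y) ∧ z ≡ x ∧ (y ∧ z)
    ∨-assoc : ∀ x y z → (x ∨ y) ∨ z ≡ x ∨ (y ∨ z)
    ∧-comm : ∀ x y → x ∧ y ≡ y ∧ x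
    ∨-comm : ∀ x y → x ∨ y ≡ y ∨ x
    ∧-absorbs-∨ : ∀ x y → x ∧ (x ∨ y) ≡ x
    ∨-absorbs-∧ : ∀ x y → x ∨ (x ∧ y) ≡ x
    𝟘-least : ∀ x → 𝟘 ∧ x ≡ 𝟘
    𝟙-greatest : ∀ x → x ∧ 𝟙 ≡ x
    ⊗-assoc : ∀ x y z → (x ⊗ y) ⊗ z ≡ x ⊗ (y ⊗ z)
    ⊗-comm : ∀ x y → x ⊗ y ≡ y ⊗ x
    ⊗-identityʳ : ∀ x → x ⊗ 𝟙 ≡ x

  _≤_ : Carrier → Carrier → Set c
  x ≤ y = x ∧ y ≡ x

  field
    residuated : ∀ x y z → ((x ⊗ y ≤ z) → (x ≤ y ⇒ z)) × ((x ≤ y ⇒ z) → (x ⊗ y ≤ z))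
    divisibility : ∀ x y → x ∧ y ≡ x ⊗ (x ⇒ y)
    prelinearity : ∀ x y → (x ⇒ y) ∨ (y ⇒ x) ≡ 𝟙

  ¬_ : Carrier → Carrier
  ¬ x = x ⇒ 𝟘

  _⊘_ : Carrier → Carrier → Carrier
  x ⊘ y = (¬ x) ⇒ y

  _⊕_ : Carrier → Carrier → Carrier
  x ⊕ y = (x ⊘ y) ∧ (y ⊘ x)

  IsChain : Set c
  IsChain = ∀ x y → (x ≤ y) ⊎ (y ≤ x)

  -- good sequences; the sequence (a₁, a₂, …) is represented as a : ℕ → Carrier
  -- with a₁ = a 0, a₂ = a 1, …
  IsGoodSequence : (ℕ → Carrier) → Set c
  IsGoodSequence a =
    (∀ i → a i ⊕ a (ℕ.suc i) ≡ a i) ×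
    (∃ λ n → ∀ r → n ℕ.≤ r → a r ≡ 𝟘)

  -- (1^p, a): first p terms 1, (p+1)-st term a, remaining terms 0 (0-indexed)
  onesThen : ℕ → Carrier → ℕ → Carrier
  onesThen p a i with i <? p
  ... | yes _ = 𝟙
  ... | no _ with i ≟ p
  ...   | yes _ = a
  ...   | no _ = 𝟘

module Submission where

-- In a totally ordered BL-algebra the defining equation
-- s i ⊕ s (i+1) = s i of a good sequence forces, for every i,
--   s i = 1   or   s (i+1) = 0,
-- because x ⊕ y is the smaller of x ⊘ y and y ⊘ x, and x ⊘ y = x (resp.
-- y ⊘ x = x) is only possible when the residuum equals 1 or y = 0.
-- In particular a term 0 is always followed by 0.  A sequence with these two
-- properties that vanishes from some index n on has the shape (1^p, a):
-- by induction on n, the tail (s 1, s 2, …) has this shape, and then either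
-- s 0 = 1 (prepend a 1) or s 1 = 0 (everything after s 0 vanishes).

open import Defs
open import Level using (Level)
open import Data.Nat as ℕ using (ℕ; zero; suc; _<_; _<?_; _≟_; z≤n; s≤s)
open import Data.Product using (Σ; _×_; _,_; proj₁)
open import Data.Nat.Properties using (≤∧≢⇒<; ≮⇒≥)
open import Data.Sum using (_⊎_; inj₁; inj₂)
open import Relation.Nullary using (yes; no)
open import Relation.Binary.PropositionalEquality
  using (_≡_; refl; sym; trans; cong; subst; module ≡-Reasoning)

module BLFacts {c : Level} (L : BLAlgebra c) where
  open BLAlgebra L
  open ≡-Reasoning

  𝟙-maximum : ∀ x → 𝟙 ≤ x → x ≡ 𝟙
  𝟙-maximum x 𝟙≤x = trans (sym (𝟙-greatest x)) (trans (∧-comm x 𝟙) 𝟙≤x)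

  -- x ≤ y implies x ⇒ y = 1 (residuation applied to 1 ⊗ x = x).
  ≤⇒residuum≡𝟙 : ∀ {x y} → x ≤ y → (x ⇒ y) ≡ 𝟙
  ≤⇒residuum≡𝟙 {x} {y} x≤y = 𝟙-maximum (x ⇒ y) (proj₁ (residuated 𝟙 x y)
    (subst (λ w → w ∧ y ≡ w) (sym (trans (⊗-comm 𝟙 x) (⊗-identityʳ x))) x≤y))

  ⊗-¬ : ∀ x → x ⊗ ¬ x ≡ 𝟘
  ⊗-¬ x = trans (sym (divisibility x 𝟘)) (trans (∧-comm x 𝟘) (𝟘-least x))

  ≤⇒factor : ∀ {x y} → y ≤ x → y ≡ x ⊗ (x ⇒ y)
  ≤⇒factor {x} {y} y≤x = trans (sym y≤x) (trans (∧-comm y x) (divisibility x y))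

  trivial : 𝟘 ≡ 𝟙 → ∀ y → y ≡ 𝟘
  trivial 𝟘≡𝟙 y = begin
    y      ≡⟨ sym (𝟙-greatest y) ⟩
    y ∧ 𝟙  ≡⟨ cong (y ∧_) (sym 𝟘≡𝟙) ⟩
    y ∧ 𝟘  ≡⟨ ∧-comm y 𝟘 ⟩
    𝟘 ∧ y  ≡⟨ 𝟘-least y ⟩
    𝟘      ∎

  ⊘-fixedʳ⇒𝟘 : ∀ {x y} → y ≤ ¬ x → x ⊘ y ≡ x → y ≡ 𝟘
  ⊘-fixedʳ⇒𝟘 {x} {y} y≤¬x fixed = begin
    y                ≡⟨ ≤⇒factor y≤¬x ⟩
    ¬ x ⊗ (x ⊘ y)    ≡⟨ cong (¬ x ⊗_) fixed ⟩
    ¬ x ⊗ x          ≡⟨ ⊗-comm (¬ x) x ⟩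
    x ⊗ ¬ x          ≡⟨ ⊗-¬ x ⟩
    𝟘                ∎

  -- If x ≤ ¬ y and y ⊘ x = x, then x = ¬ y ⊗ x; moreover y ≤ x because
  -- y ⊗ ¬ y = 0, so y = x ⊗ (x ⇒ y) = ¬ y ⊗ y = 0.
  ⊘-fixedˡ⇒𝟘 : ∀ {x y} → x ≤ ¬ y → y ⊘ x ≡ x → y ≡ 𝟘
  ⊘-fixedˡ⇒𝟘 {x} {y} x≤¬y fixed = begin
    y                        ≡⟨ ≤⇒factor y≤x ⟩
    x ⊗ (x ⇒ y)              ≡⟨ cong (_⊗ (x ⇒ y)) x≡¬y⊗x ⟩
    (¬ y ⊗ x) ⊗ (x ⇒ y)      ≡⟨ ⊗-assoc (¬ y) x (x ⇒ y) ⟩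
    ¬ y ⊗ (x ⊗ (x ⇒ y))      ≡⟨ cong (¬ y ⊗_) (sym (≤⇒factor y≤x)) ⟩
    ¬ y ⊗ y                  ≡⟨ ⊗-comm (¬ y) y ⟩
    y ⊗ ¬ y                  ≡⟨ ⊗-¬ y ⟩
    𝟘                        ∎
    where
    x≡¬y⊗x : x ≡ ¬ y ⊗ x
    x≡¬y⊗x = trans (≤⇒factor x≤¬y) (cong (¬ y ⊗_) fixed)

    y≤x : y ≤ x
    y≤x = subst (λ w → y ≤ w) fixed (proj₁ (residuated y (¬ y) x)
      (trans (cong (_∧ x) (⊗-¬ y)) (trans (𝟘-least x) (sym (⊗-¬ y)))))

module ChainFacts {c : Level} (L : BLAlgebra c) (chain : BLAlgebra.IsChain L) where
  open BLAlgebra L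
  open BLFacts L

  ∧-selective : ∀ x y → (x ∧ y ≡ x) ⊎ (x ∧ y ≡ y)
  ∧-selective x y with chain x y
  ... | inj₁ x≤y = inj₁ x≤y
  ... | inj₂ y≤x = inj₂ (trans (∧-comm x y) y≤x)

  ⊘-fixedʳ : ∀ x y → x ⊘ y ≡ x → (x ≡ 𝟙) ⊎ (y ≡ 𝟘)
  ⊘-fixedʳ x y fixed with chain (¬ x) y
  ... | inj₁ ¬x≤y = inj₁ (trans (sym fixed) (≤⇒residuum≡𝟙 ¬x≤y))
  ... | inj₂ y≤¬x = inj₂ (⊘-fixedʳ⇒𝟘 y≤¬x fixed)

  ⊘-fixedˡ : ∀ x y → y ⊘ x ≡ x → (x ≡ 𝟙) ⊎ (y ≡ 𝟘)
  ⊘-fixedˡ x y fixed with chain x (¬ y)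
  ... | inj₁ x≤¬y = inj₂ (⊘-fixedˡ⇒𝟘 x≤¬y fixed)
  ... | inj₂ ¬y≤x = inj₁ (trans (sym fixed) (≤⇒residuum≡𝟙 ¬y≤x))

  -- The key dichotomy: x ⊕ y is x ⊘ y or y ⊘ x, so x ⊕ y = x forces
  -- x = 1 or y = 0.
  ⊕-fixed : ∀ x y → x ⊕ y ≡ x → (x ≡ 𝟙) ⊎ (y ≡ 𝟘)
  ⊕-fixed x y fixed with ∧-selective (x ⊘ y) (y ⊘ x)
  ... | inj₁ ⊕≡x⊘y = ⊘-fixedʳ x y (trans (sym ⊕≡x⊘y) fixed)
  ... | inj₂ ⊕≡y⊘x = ⊘-fixedˡ x y (trans (sym ⊕≡y⊘x) fixed)

  𝟘⊕-fixed : ∀ y → 𝟘 ⊕ y ≡ 𝟘 → y ≡ 𝟘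
  𝟘⊕-fixed y fixed with ⊕-fixed 𝟘 y fixed
  ... | inj₁ 𝟘≡𝟙 = trivial 𝟘≡𝟙 y
  ... | inj₂ y≡𝟘 = y≡𝟘

module Shape {c : Level} (L : BLAlgebra c) where
  open BLAlgebra L

  OnesThen : ℕ → Carrier → (ℕ → Carrier) → Set c
  OnesThen p a s = (∀ i → i < p → s i ≡ 𝟙) × (s p ≡ a) × (∀ i → p < i → s i ≡ 𝟘)

  OnesThen⇒onesThen : ∀ {p a s} → OnesThen p a s → ∀ i → s i ≡ onesThen p a i
  OnesThen⇒onesThen {p} (ones , middle , zeros) i with i <? p
  ... | yes i<p = ones i i<p
  ... | no i≮p with i ≟ p
  ...   | yes refl = middle
  ...   | no i≢p = zeros i (≤∧≢⇒< (≮⇒≥ i≮p) (λ p≡i → i≢p (sym p≡i)))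

  zero-forever : ∀ (s : ℕ → Carrier) → (∀ i → s i ≡ 𝟘 → s (suc i) ≡ 𝟘) →
    s 0 ≡ 𝟘 → ∀ i → s i ≡ 𝟘
  zero-forever s persist s0≡𝟘 zero = s0≡𝟘
  zero-forever s persist s0≡𝟘 (suc i) = persist i (zero-forever s persist s0≡𝟘 i)

  cons-𝟙 : ∀ {p a} (s : ℕ → Carrier) → s 0 ≡ 𝟙 →
    OnesThen p a (λ i → s (suc i)) → OnesThen (suc p) a s
  cons-𝟙 {p} s s0≡𝟙 (ones , middle , zeros) = ones′ , middle , zeros′
    where
    ones′ : ∀ i → i < suc p → s i ≡ 𝟙
    ones′ zero    _         = s0≡𝟙
    ones′ (suc i) (s≤s i<p) = ones i i<p
    zeros′ : ∀ i → suc p < i → s i ≡ 𝟘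
    zeros′ (suc i) (s≤s p<i) = zeros i p<i

  head-then-zeros : ∀ (s : ℕ → Carrier) → (∀ i → s (suc i) ≡ 𝟘) → OnesThen 0 (s 0) s
  head-then-zeros s tail≡𝟘 = (λ i ()) , refl , zeros
    where
    zeros : ∀ i → 0 < i → s i ≡ 𝟘
    zeros (suc i) _ = tail≡𝟘 i

  staircase : ∀ (s : ℕ → Carrier) →
    (∀ i → (s i ≡ 𝟙) ⊎ (s (suc i) ≡ 𝟘)) →
    (∀ i → s i ≡ 𝟘 → s (suc i) ≡ 𝟘) →
    ∀ n → (∀ r → n ℕ.≤ r → s r ≡ 𝟘) →
    Σ ℕ λ p → Σ Carrier λ a → OnesThen p a s
  staircase s step persist zero vanish =
    0 , s 0 , head-then-zeros s (λ i → vanish (suc i) z≤n)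
  staircase s step persist (suc n) vanish
    with step 0 | staircase (λ i → s (suc i)) (λ i → step (suc i)) (λ i → persist (suc i)) n
                            (λ r n≤r → vanish (suc r) (s≤s n≤r))
  ... | inj₁ s0≡𝟙 | p , a , tail-shape = suc p , a , cons-𝟙 s s0≡𝟙 tail-shape
  ... | inj₂ s1≡𝟘 | _ = 0 , s 0 , head-then-zeros s
          (zero-forever (λ i → s (suc i)) (λ i → persist (suc i)) s1≡𝟘)

proposition4p3 : ∀ {c : Level} (L : BLAlgebra c) → BLAlgebra.IsChain L →
    (s : ℕ → BLAlgebra.Carrier L) → BLAlgebra.IsGoodSequence L s →
    Σ ℕ λ p → Σ (BLAlgebra.Carrier L) λ a → ∀ i → s i ≡ BLAlgebra.onesThen L p a i
proposition4p3 L chain s (good , n , vanish) =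
  let (p , a , shape) = staircase s step persist n vanish
  in p , a , OnesThen⇒onesThen shape
  where
  open BLAlgebra L
  open ChainFacts L chain
  open Shape L

  step : ∀ i → (s i ≡ 𝟙) ⊎ (s (suc i) ≡ 𝟘)
  step i = ⊕-fixed (s i) (s (suc i)) (good i)

  persist : ∀ i → s i ≡ 𝟘 → s (suc i) ≡ 𝟘
  persist i si≡𝟘 = 𝟘⊕-fixed (s (suc i)) (subst (λ w → w ⊕ s (suc i) ≡ w) si≡𝟘 (good i))
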